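{- Let $G$ be a simple graph and $D$ an orientation of $G$. Then $M_1(D)\leq \frac{M_1(G)}{2}$, with equality if and only if $D$ is a sink-source orientation of $G$.
   Context: For a graph $G$, $M_1(G)=\sum_{uv\in E(G)}(d_G(u)+d_G(v))$, where $d_G$ is the degree. For a digraph $D=(V,A)$ with out-degrees $d^{+}$ and in-degrees $d^{ - }$, $M_1(D)=\frac{1}{2}\sum_{uv\in A}(d^{+}_u+d^{ - }_v)$, where $uv$ is an arc from $u$ to $v$. An orientation of $G$ replaces each edge $uv$ by exactly one of the arcs $uv$, $vu$. A sink-source orientation is an orientation in which every vertex $u$ satisfies $d^{+}_u=0$ or $d^{ - }_u=0$. -}

module Defs where

open import Data.Nat using (ℕ; zero; suc; _+_)
open import Data.Nat.ListAction using (sum)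
open import Data.Fin using (Fin)
open import Data.Fin.Properties using (_≟_)
open import Data.Bool using (Bool; true; false; _∨_)
open import Data.Product using (_×_; _,_; proj₁; proj₂)
open import Data.Sum using (_⊎_)
open import Data.List using (List; []; _∷_; map)
open import Data.List.Relation.Unary.All using (All)
open import Data.List.Relation.Unary.AllPairs using (AllPairs)
open import Data.List.Relation.Binary.Pointwise using (Pointwise)
open import Relation.Nullary using (¬_; ⌊_⌋)
open import Relation.Binary.PropositionalEquality using (_≡_; _≢_)

-- An (ordered) pair of vertices; used both for edges (read unordered) and arcs (u , v) = u → v.
Pair : ℕ → Set
Pair n = Fin n × Fin n

SameEdge : ∀ {n} → Pair n → Pair n → Set
SameEdge (u , v) (x , y) = ((u ≡ x) × (v ≡ y)) ⊎ ((u ≡ y) × (v ≡ x))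

record SimpleGraph (n : ℕ) : Set where
  field
    edges    : List (Pair n)
    loopless : All (λ e → proj₁ e ≢ proj₂ e) edges
    noMulti  : AllPairs (λ e f → ¬ SameEdge e f) edges
open SimpleGraph public

IsOrientation : ∀ {n} → SimpleGraph n → List (Pair n) → Set
IsOrientation G arcs =
  Pointwise (λ e a → (a ≡ e) ⊎ (a ≡ (proj₂ e , proj₁ e))) (edges G) arcs

countB : ∀ {A : Set} → (A → Bool) → List A → ℕ
countB p [] = 0
countB p (x ∷ xs) with p x
... | true  = suc (countB p xs)
... | false = countB p xs

deg : ∀ {n} → List (Pair n) → Fin n → ℕ
deg es v = countB (λ e → ⌊ proj₁ e ≟ v ⌋ ∨ ⌊ proj₂ e ≟ v ⌋) es

outdeg : ∀ {n} → List (Pair n) → Fin n → ℕ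
outdeg as v = countB (λ a → ⌊ proj₁ a ≟ v ⌋) as

indeg : ∀ {n} → List (Pair n) → Fin n → ℕ
indeg as v = countB (λ a → ⌊ proj₂ a ≟ v ⌋) as

M1G : ∀ {n} → SimpleGraph n → ℕ
M1G G = sum (map (λ e → deg (edges G) (proj₁ e) + deg (edges G) (proj₂ e)) (edges G))

-- 2·M₁(D) = Σ_{uv ∈ A} (d⁺(u) + d⁻(v))   (twice the paper's M₁(D), to stay in ℕ)
twiceM1D : ∀ {n} → List (Pair n) → ℕ
twiceM1D as = sum (map (λ a → outdeg as (proj₁ a) + indeg as (proj₂ a)) as)

IsSinkSource : ∀ {n} → List (Pair n) → Set
IsSinkSource {n} as = (u : Fin n) → (outdeg as u ≡ 0) ⊎ (indeg as u ≡ 0)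

{-# OPTIONS --safe #-}
module Submission where

-- Every edge uv of G, oriented as the arc a = (t , h), contributes
-- d(t) + d(h) = (d⁺t + d⁻t) + (d⁻h + d⁺h) = (d⁺t + d⁻h) + (d⁻t + d⁺h) to M₁(G),
-- so M₁(G) = 2M₁(D) + Σ_{th ∈ A} (d⁻t + d⁺h). The second sum vanishes iff no
-- tail of an arc has an incoming arc and no head has an outgoing one, which is
-- the sink-source condition.

open import Defs
open import Algebra.Properties.CommutativeSemigroup using (interchange)
open import Data.Bool using (Bool; true; false; _∧_; _∨_; T)
open import Data.Fin using (Fin)
open import Data.Fin.Properties using (_≟_)
open import Data.List using (List; []; _∷_; map)
open import Data.List.Membership.Propositional using (_∈_)
open import Data.List.Relation.Binary.Pointwise as Pointwise
  using (Pointwise; []; _∷_; Pointwise-≡⇒≡)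
open import Data.List.Relation.Unary.All as All using (All; []; _∷_)
open import Data.List.Relation.Unary.Any as Any using (Any; here; there)
open import Data.Nat using (ℕ; _+_; _≤_)
open import Data.Nat.ListAction using (sum)
open import Data.Nat.Properties
  using (+-comm; +-identityʳ; +-cancelˡ-≡; m≤m+n; m+n≡0⇒m≡0; m+n≡0⇒n≡0; +-commutativeSemigroup)
open import Data.Product using (_×_; _,_; proj₁; proj₂)
open import Data.Sum using (_⊎_; inj₁; inj₂; [_,_]′)
open import Function using (_∘_; id)
open import Function.Bundles using (_⇔_; mk⇔)
open import Function.Construct.Composition using (_⇔-∘_)
open import Relation.Nullary using (⌊_⌋; yes; no; contradiction)
open import Relation.Nullary.Decidable using (toWitness; fromWitness)
open import Relation.Binary.PropositionalEquality
  using (_≡_; _≢_; refl; sym; trans; cong; cong₂; subst; module ≡-Reasoning)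

open ≡-Reasoning

+-interchange : ∀ a b c d → (a + b) + (c + d) ≡ (a + c) + (b + d)
+-interchange = interchange +-commutativeSemigroup

m≡m+n⇔n≡0 : ∀ m {n} → m ≡ m + n ⇔ n ≡ 0
m≡m+n⇔n≡0 m {n} = mk⇔
  (λ m≡m+n → +-cancelˡ-≡ m n 0 (trans (sym m≡m+n) (sym (+-identityʳ m))))
  (λ { refl → sym (+-identityʳ m) })

sum-map-+ : ∀ {A : Set} (f g : A → ℕ) xs →
            sum (map (λ x → f x + g x) xs) ≡ sum (map f xs) + sum (map g xs)
sum-map-+ f g []       = refl
sum-map-+ f g (x ∷ xs) = begin
  (f x + g x) + sum (map (λ x → f x + g x) xs)   ≡⟨ cong (f x + g x +_) (sum-map-+ f g xs) ⟩
  (f x + g x) + (sum (map f xs) + sum (map g xs)) ≡⟨ +-interchange (f x) (g x) _ _ ⟩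
  (f x + sum (map f xs)) + (g x + sum (map g xs)) ∎

sum-map-Pointwise : ∀ {A B : Set} {R : A → B → Set} (f : A → ℕ) (g : B → ℕ) {xs ys} →
                    (∀ {x y} → R x y → f x ≡ g y) → Pointwise R xs ys →
                    sum (map f xs) ≡ sum (map g ys)
sum-map-Pointwise f g f≡g rs =
  cong sum (Pointwise-≡⇒≡ (Pointwise.map⁺ f g (Pointwise.map f≡g rs)))

sum-map≡0⇒All : ∀ {A : Set} (f : A → ℕ) xs → sum (map f xs) ≡ 0 → All (λ x → f x ≡ 0) xs
sum-map≡0⇒All f []       _  = []
sum-map≡0⇒All f (x ∷ xs) eq = m+n≡0⇒m≡0 (f x) eq ∷ sum-map≡0⇒All f xs (m+n≡0⇒n≡0 (f x) eq)

All⇒sum-map≡0 : ∀ {A : Set} (f : A → ℕ) {xs} → All (λ x → f x ≡ 0) xs → sum (map f xs) ≡ 0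
All⇒sum-map≡0 f []           = refl
All⇒sum-map≡0 f (fx≡0 ∷ all) = cong₂ _+_ fx≡0 (All⇒sum-map≡0 f all)

toℕ : Bool → ℕ
toℕ true  = 1
toℕ false = 0

countB-∷ : ∀ {A : Set} (p : A → Bool) x xs → countB p (x ∷ xs) ≡ toℕ (p x) + countB p xs
countB-∷ p x xs with p x
... | true  = refl
... | false = refl

countB≡0⊎Any : ∀ {A : Set} (p : A → Bool) xs → countB p xs ≡ 0 ⊎ Any (T ∘ p) xs
countB≡0⊎Any p []       = inj₁ refl
countB≡0⊎Any p (x ∷ xs) with p x in px | countB≡0⊎Any p xs
... | true  | _               = inj₂ (here (subst T (sym px) _))
... | false | inj₁ count≡0    = inj₁ count≡0
... | false | inj₂ any        = inj₂ (there any)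

Any⇒countB≢0 : ∀ {A : Set} (p : A → Bool) {xs} → Any (T ∘ p) xs → countB p xs ≢ 0
Any⇒countB≢0 p {x ∷ xs} (here  px)  with p x
... | true = λ ()
Any⇒countB≢0 p {x ∷ xs} (there any) count≡0 =
  Any⇒countB≢0 p any (m+n≡0⇒n≡0 (toℕ (p x)) (trans (sym (countB-∷ p x xs)) count≡0))

toℕ-∨ : ∀ x y → x ∧ y ≡ false → toℕ (x ∨ y) ≡ toℕ x + toℕ y
toℕ-∨ true  true  ()
toℕ-∨ true  false _ = refl
toℕ-∨ false y     _ = refl

-- Chosen so that Pointwise Orients (edges G) is IsOrientation G definitionally.
Orients : ∀ {n} → Pair n → Pair n → Set
Orients e a = (a ≡ e) ⊎ (a ≡ (proj₂ e , proj₁ e))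

≢⇒¬both≟ : ∀ {n} {u w : Fin n} → u ≢ w → ∀ v → ⌊ u ≟ v ⌋ ∧ ⌊ w ≟ v ⌋ ≡ false
≢⇒¬both≟ {u = u} {w} u≢w v with u ≟ v | w ≟ v
... | yes refl | yes refl = contradiction refl u≢w
... | yes _    | no _     = refl
... | no _     | _        = refl

incidence-split : ∀ {n} {e a : Pair n} → proj₁ e ≢ proj₂ e → Orients e a → ∀ v →
                  toℕ (⌊ proj₁ e ≟ v ⌋ ∨ ⌊ proj₂ e ≟ v ⌋)
                    ≡ toℕ ⌊ proj₁ a ≟ v ⌋ + toℕ ⌊ proj₂ a ≟ v ⌋
incidence-split {e = u , w} u≢w (inj₁ refl) v = toℕ-∨ ⌊ u ≟ v ⌋ ⌊ w ≟ v ⌋ (≢⇒¬both≟ u≢w v)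
incidence-split {e = u , w} u≢w (inj₂ refl) v =
  trans (toℕ-∨ ⌊ u ≟ v ⌋ ⌊ w ≟ v ⌋ (≢⇒¬both≟ u≢w v)) (+-comm (toℕ ⌊ u ≟ v ⌋) _)

deg≡outdeg+indeg : ∀ {n} {es as : List (Pair n)} → All (λ e → proj₁ e ≢ proj₂ e) es →
                   Pointwise Orients es as → ∀ v → deg es v ≡ outdeg as v + indeg as v
deg≡outdeg+indeg []          []          v = refl
deg≡outdeg+indeg {es = e ∷ es} {a ∷ as} (u≢w ∷ loopless) (orients ∷ orientation) v = begin
  deg (e ∷ es) v
    ≡⟨ countB-∷ _ e es ⟩
  toℕ (⌊ proj₁ e ≟ v ⌋ ∨ ⌊ proj₂ e ≟ v ⌋) + deg es v
    ≡⟨ cong₂ _+_ (incidence-split u≢w orients v) (deg≡outdeg+indeg loopless orientation v) ⟩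
  (toℕ ⌊ proj₁ a ≟ v ⌋ + toℕ ⌊ proj₂ a ≟ v ⌋) + (outdeg as v + indeg as v)
    ≡⟨ +-interchange (toℕ ⌊ proj₁ a ≟ v ⌋) _ _ _ ⟩
  (toℕ ⌊ proj₁ a ≟ v ⌋ + outdeg as v) + (toℕ ⌊ proj₂ a ≟ v ⌋ + indeg as v)
    ≡⟨ sym (cong₂ _+_ (countB-∷ (λ b → ⌊ proj₁ b ≟ v ⌋) a as)
                      (countB-∷ (λ b → ⌊ proj₂ b ≟ v ⌋) a as)) ⟩
  outdeg (a ∷ as) v + indeg (a ∷ as) v
    ∎

∈⇒outdeg-tail≢0 : ∀ {n} {a : Pair n} {as} → a ∈ as → outdeg as (proj₁ a) ≢ 0
∈⇒outdeg-tail≢0 a∈as = Any⇒countB≢0 _ (Any.map (λ { refl → fromWitness refl }) a∈as)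

∈⇒indeg-head≢0 : ∀ {n} {a : Pair n} {as} → a ∈ as → indeg as (proj₂ a) ≢ 0
∈⇒indeg-head≢0 a∈as = Any⇒countB≢0 _ (Any.map (λ { refl → fromWitness refl }) a∈as)

M1D-defect : ∀ {n} → List (Pair n) → ℕ
M1D-defect as = sum (map (λ a → indeg as (proj₁ a) + outdeg as (proj₂ a)) as)

M1G≡twiceM1D+defect : ∀ {n} (G : SimpleGraph n) (D : List (Pair n)) → IsOrientation G D →
                      M1G G ≡ twiceM1D D + M1D-defect D
M1G≡twiceM1D+defect G D orientation =
  trans (sum-map-Pointwise _ (λ a → arcTerm a + defectTerm a) endpoint-split orientation)
        (sum-map-+ arcTerm defectTerm D)
  where
  d : Fin _ → ℕ
  d = deg (edges G)

  arcTerm defectTerm : Pair _ → ℕ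
  arcTerm    a = outdeg D (proj₁ a) + indeg D (proj₂ a)
  defectTerm a = indeg D (proj₁ a) + outdeg D (proj₂ a)

  d≡outdeg+indeg : ∀ v → d v ≡ outdeg D v + indeg D v
  d≡outdeg+indeg = deg≡outdeg+indeg (loopless G) orientation

  arc-split : ∀ a → d (proj₁ a) + d (proj₂ a) ≡ arcTerm a + defectTerm a
  arc-split (x , y) = begin
    d x + d y
      ≡⟨ cong₂ _+_ (d≡outdeg+indeg x) (trans (d≡outdeg+indeg y) (+-comm (outdeg D y) _)) ⟩
    (outdeg D x + indeg D x) + (indeg D y + outdeg D y)
      ≡⟨ +-interchange (outdeg D x) _ _ _ ⟩
    (outdeg D x + indeg D y) + (indeg D x + outdeg D y)
      ∎

  endpoint-split : ∀ {e a} → Orients e a → d (proj₁ e) + d (proj₂ e) ≡ arcTerm a + defectTerm a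
  endpoint-split {e} (inj₁ refl) = arc-split e
  endpoint-split {e} (inj₂ refl) = trans (+-comm (d (proj₁ e)) _) (arc-split (proj₂ e , proj₁ e))

M1D-defect≡0⇔IsSinkSource : ∀ {n} (D : List (Pair n)) → M1D-defect D ≡ 0 ⇔ IsSinkSource D
M1D-defect≡0⇔IsSinkSource D = mk⇔ to from
  where
  I O : Fin _ → ℕ
  I = indeg D
  O = outdeg D

  to : M1D-defect D ≡ 0 → IsSinkSource D
  to defect≡0 w with countB≡0⊎Any (λ a → ⌊ proj₁ a ≟ w ⌋) D
  ... | inj₁ out≡0 = inj₁ out≡0
  ... | inj₂ tail-at-w = inj₂ (All.lookupWith in≡0 (sum-map≡0⇒All _ D defect≡0) tail-at-w)
    where
    in≡0 : ∀ {a} → I (proj₁ a) + O (proj₂ a) ≡ 0 → T ⌊ proj₁ a ≟ w ⌋ → I w ≡ 0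
    in≡0 defect-a≡0 tail≡w =
      subst (λ x → I x ≡ 0) (toWitness tail≡w) (m+n≡0⇒m≡0 _ defect-a≡0)

  from : IsSinkSource D → M1D-defect D ≡ 0
  from sinkSource =
    All⇒sum-map≡0 _ (All.tabulate λ a∈D → cong₂ _+_ (tail-source a∈D) (head-sink a∈D))
    where
    tail-source : ∀ {a} → a ∈ D → I (proj₁ a) ≡ 0
    tail-source {a} a∈D =
      [ (λ out≡0 → contradiction out≡0 (∈⇒outdeg-tail≢0 a∈D)) , id ]′ (sinkSource (proj₁ a))

    head-sink : ∀ {a} → a ∈ D → O (proj₂ a) ≡ 0
    head-sink {a} a∈D =
      [ id , (λ in≡0 → contradiction in≡0 (∈⇒indeg-head≢0 a∈D)) ]′ (sinkSource (proj₂ a))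

lemma4 : ∀ {n : ℕ} (G : SimpleGraph n) (D : List (Pair n)) → IsOrientation G D →
         (twiceM1D D ≤ M1G G) × (twiceM1D D ≡ M1G G ⇔ IsSinkSource D)
lemma4 G D orientation rewrite M1G≡twiceM1D+defect G D orientation =
  m≤m+n _ _ , M1D-defect≡0⇔IsSinkSource D ⇔-∘ m≡m+n⇔n≡0 (twiceM1D D)
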